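{- Let $G$ be a graph, let $F$ be a minimum feedback edge set of $G$ with $|F|=k$, and let $G_j$ be the graph constructed as follows. Let $G'$ be obtained from $G$ by exhaustively removing vertices of degree $0$ or $1$. Let $T$ be the forest with $V(T)=V(G')$ and $E(T)=E(G')\setminus F$. Let $C$ be the union of $\{u\in V(T)\mid \deg_T(u)\ge 3\}$ and the set of endpoints of edges of $F$. Decompose $T$ into the (unique) edge-disjoint paths $P_1,\dots,P_x$ whose endpoints lie in $C$ and whose internal vertices lie outside $C$, sorted so that $|E(P_1)|\le\dots\le|E(P_x)|$. Let $G_0$ have vertex set $C$ and edge set $F$, and let $G_i=G_0\cup P_1\cup\dots\cup P_i$ for $i\in[x]$. Let $j$ be the smallest $i\in\{0,\dots,x-1\}$ with $|E(P_{i+1})|>2(|E(G_i)|+x)$ if such an $i$ exists, and $j=x$ otherwise. Then $G_j$ has at most $10k\cdot 81^k$ vertices.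
   Context: A feedback edge set of a graph is a set of edges whose removal makes the graph acyclic. -}

module Defs where

open import Data.Nat using (ℕ; zero; suc; _+_; _*_; _∸_; _^_; _≤_; _<_; _<ᵇ_; _≤ᵇ_)
open import Data.Bool using (Bool; true; false; _∧_; _∨_; not; if_then_else_)
open import Data.Fin using (Fin; toℕ; _≟_)
import Data.Fin as Fin
open import Data.List using (List; []; _∷_; _++_; length; map; allFin)
open import Data.Nat.ListAction using (sum)
open import Data.Bool.ListAction using (any)
open import Data.List.Relation.Unary.All using (All)
open import Data.List.Relation.Unary.Unique.Propositional using (Unique)
open import Data.Product using (Σ; Σ-syntax; ∃; ∃-syntax; _×_; _,_)
open import Data.Unit using (⊤)
open import Relation.Nullary using (¬_; does)
open import Relation.Binary.PropositionalEquality using (_≡_)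

EdgeRel : ℕ → Set
EdgeRel n = Fin n → Fin n → Bool

VSet : ℕ → Set
VSet n = Fin n → Bool

record Graph (n : ℕ) : Set where
  field
    adj    : EdgeRel n
    sym    : ∀ u v → adj u v ≡ adj v u
    irrefl : ∀ u → adj u u ≡ false
open Graph public

count : {A : Set} → (A → Bool) → List A → ℕ
count p []       = 0
count p (x ∷ xs) = (if p x then 1 else 0) + count p xs

numEdges : ∀ {n} → EdgeRel n → ℕ
numEdges {n} R =
  sum (map (λ u → count (λ v → (toℕ u <ᵇ toℕ v) ∧ R u v) (allFin n)) (allFin n))

size : ∀ {n} → VSet n → ℕ
size {n} S = count S (allFin n)

deg : ∀ {n} → EdgeRel n → Fin n → ℕ
deg {n} R u = count (R u) (allFin n)

eqB : ∀ {n} → Fin n → Fin n → Bool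
eqB u v = does (u ≟ v)

Chain : ∀ {n} → EdgeRel n → List (Fin n) → Set
Chain R []           = ⊤
Chain R (x ∷ [])     = ⊤
Chain R (x ∷ y ∷ xs) = (R x y ≡ true) × Chain R (y ∷ xs)

-- v ∷ vs is a cycle: at least 3 distinct vertices, consecutive ones
-- adjacent, and the last adjacent to the first.
IsCycle : ∀ {n} → EdgeRel n → Fin n → List (Fin n) → Set
IsCycle R v vs = (2 ≤ length vs) × Unique (v ∷ vs) × Chain R (v ∷ vs ++ v ∷ [])

Acyclic : ∀ {n} → EdgeRel n → Set
Acyclic R = ∀ v vs → ¬ IsCycle R v vs

_─_ : ∀ {n} → EdgeRel n → EdgeRel n → EdgeRel n
(R ─ F) u v = R u v ∧ not (F u v)

IsFeedbackEdgeSet : ∀ {n} → Graph n → EdgeRel n → Set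
IsFeedbackEdgeSet G F =
  (∀ u v → F u v ≡ true → adj G u v ≡ true) ×
  (∀ u v → F u v ≡ F v u) ×
  Acyclic (adj G ─ F)

IsMinFeedbackEdgeSet : ∀ {n} → Graph n → EdgeRel n → Set
IsMinFeedbackEdgeSet G F =
  IsFeedbackEdgeSet G F ×
  (∀ F' → IsFeedbackEdgeSet G F' → numEdges F ≤ numEdges F')

induced : ∀ {n} → EdgeRel n → VSet n → EdgeRel n
induced R S u v = R u v ∧ S u ∧ S v

removeV : ∀ {n} → Fin n → VSet n → VSet n
removeV v S w = S w ∧ not (eqB w v)

data Peels {n} (G : Graph n) : VSet n → VSet n → Set where
  done : ∀ {S} → Peels G S S
  step : ∀ {S S'} v → S v ≡ true → deg (induced (adj G) S) v ≤ 1 →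
         Peels G (removeV v S) S' → Peels G S S'

-- S is a possible outcome of exhaustively removing vertices of degree 0/1
-- from G (i.e. V(G')).
IsExhaustivePeel : ∀ {n} → Graph n → VSet n → Set
IsExhaustivePeel {n} G S =
  Peels G (λ _ → true) S ×
  (∀ v → S v ≡ true → 2 ≤ deg (induced (adj G) S) v)

forestT : ∀ {n} → Graph n → VSet n → EdgeRel n → EdgeRel n
forestT G S F = induced (adj G) S ─ F

setC : ∀ {n} → Graph n → VSet n → EdgeRel n → VSet n
setC {n} G S F u = (S u ∧ (3 ≤ᵇ deg (forestT G S F) u)) ∨ any (F u) (allFin n)

IsCPath : ∀ {n} → EdgeRel n → VSet n → List (Fin n) → Set
IsCPath {n} T C p =
  Unique p × Chain T p ×
  (Σ[ a ∈ Fin n ] Σ[ mid ∈ List (Fin n) ] Σ[ b ∈ Fin n ]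
     (p ≡ a ∷ mid ++ b ∷ []) × (C a ≡ true) × (C b ≡ true) ×
     All (λ w → C w ≡ false) mid)

pathLen : ∀ {n} → List (Fin n) → ℕ
pathLen p = length p ∸ 1

edgeIn : ∀ {n} → Fin n → Fin n → List (Fin n) → Bool
edgeIn u v []           = false
edgeIn u v (x ∷ [])     = false
edgeIn u v (x ∷ y ∷ xs) =
  (eqB x u ∧ eqB y v) ∨ (eqB x v ∧ eqB y u) ∨ edgeIn u v (y ∷ xs)

memB : ∀ {n} → Fin n → List (Fin n) → Bool
memB w p = any (eqB w) p

-- P₁,…,Pₓ (indexed by Fin x, P (i) = P_{i+1}) decompose T into edge-disjoint
-- C-paths, sorted by nondecreasing number of edges.
IsSortedDecomposition : ∀ {n} → EdgeRel n → VSet n → (x : ℕ) →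
                        (Fin x → List (Fin n)) → Set
IsSortedDecomposition {n} T C x P =
  (∀ i → IsCPath T C (P i)) ×
  (∀ u v → T u v ≡ true → ∃[ i ] (edgeIn u v (P i) ≡ true)) ×
  (∀ u v i i' → edgeIn u v (P i) ≡ true → edgeIn u v (P i') ≡ true → i ≡ i') ×
  (∀ i i' → i Fin.≤ i' → pathLen (P i) ≤ pathLen (P i'))

edgesGi : ∀ {n x} → EdgeRel n → (Fin x → List (Fin n)) → ℕ → EdgeRel n
edgesGi {n} {x} F P i u v =
  F u v ∨ any (λ l → (toℕ l <ᵇ i) ∧ edgeIn u v (P l)) (allFin x)

vertsGi : ∀ {n x} → VSet n → (Fin x → List (Fin n)) → ℕ → VSet n
vertsGi {n} {x} C P i w =
  C w ∨ any (λ l → (toℕ l <ᵇ i) ∧ memB w (P l)) (allFin x)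

IsThresholdIndex : ∀ {n} → EdgeRel n → (x : ℕ) → (Fin x → List (Fin n)) → ℕ → Set
IsThresholdIndex F x P j =
  (j ≤ x) ×
  (∀ (l : Fin x) → toℕ l < j → pathLen (P l) ≤ 2 * (numEdges (edgesGi F P (toℕ l)) + x)) ×
  (∀ (l : Fin x) → toℕ l ≡ j → 2 * (numEdges (edgesGi F P j) + x) < pathLen (P l))

-- Every vertex of G' has degree at least 2 in T ∪ F, T is a forest on V(G'), and the F-degrees
-- add up to 2k.  Comparing these degree sums with the forest bound Σ deg_T ≤ 2|V(G')| − 2 shows
-- that fewer than 2k vertices of T have degree ≥ 3 and no F-edge, so |C| ≤ 4k.  The same
-- comparison bounds the total T-degree of C by 8k − 6; each path P_i has its two end edges at C
-- and the paths are edge-disjoint, so x ≤ 4k − 3 (or x = 0 when G' is empty).  Below the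
-- threshold, P_{i+1} has at most 2(|E(G_i)| + x) + 1 vertices and |E(G_i)| ≤ k + u_i, where u_i
-- counts the vertices of P_1, …, P_i with multiplicity; so u_{i+1} + c ≤ 3(u_i + c) for
-- c = k + x + 1, and |V(G_j)| ≤ |C| + u_j ≤ 4k + 3^j c ≤ 4k + 81^k · 5k because j ≤ x < 4k.
module Submission where

open import Data.Nat.Properties hiding (_≟_)
open import Algebra.Properties.Semiring.Sum +-*-semiring
  using (sum; sum-syntax; sum-cong-≗; ∑-distrib-+; ∑-comm; *-distribˡ-sum; sum-replicate-zero)
open import Data.Bool using (Bool; true; false; _∧_; _∨_; not; if_then_else_)
import Data.Bool.Properties as Bool
open import Data.Bool.ListAction using (any)
open import Data.Empty using (⊥; ⊥-elim)
open import Data.Fin using (Fin; toℕ; zero; suc; _≟_; fromℕ<)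
import Data.Fin.Properties as Finₚ
open import Data.List using (List; []; _∷_; _++_; length; map; allFin; tabulate)
open import Data.List.Properties using (map-tabulate; ++-assoc)
open import Data.List.Membership.Propositional.Properties using (∈-∃++)
open import Data.List.Relation.Unary.All using ([]; _∷_)
import Data.List.Relation.Unary.All.Properties as All
open import Data.List.Relation.Unary.AllPairs using ([]; _∷_)
open import Data.List.Relation.Unary.Any using (here; there)
open import Data.List.Relation.Unary.Unique.Propositional using (Unique)
open import Data.Nat using (ℕ; zero; suc; _+_; _*_; _^_; _≤_; _<_; _<ᵇ_; _≤ᵇ_; z≤n; s≤s; s≤s⁻¹; _≤?_)
import Data.Nat.ListAction as ℕ-List
open import Data.Nat.Tactic.RingSolver using (solve-∀)
open import Data.Product using (∃-syntax; _×_; _,_; proj₁; proj₂)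
open import Data.Sum using (_⊎_; inj₁; inj₂)
open import Data.Unit using (tt)
open import Defs hiding (sym)
open import Function using (_∘_)
open import Relation.Binary.PropositionalEquality
open import Relation.Nullary using (yes; no; contradiction)
open import Relation.Nullary.Decidable using (does; dec-true; dec-false; _×-dec_; ¬?)
open import Relation.Nullary.Reflects using (ofʸ; ofⁿ)

-- Finite sums and counting

𝟙 : Bool → ℕ
𝟙 b = if b then 1 else 0

𝟙≤1 : ∀ b → 𝟙 b ≤ 1
𝟙≤1 true  = ≤-refl
𝟙≤1 false = z≤n

𝟙-∨ : ∀ a b → 𝟙 (a ∨ b) ≤ 𝟙 a + 𝟙 b
𝟙-∨ true  _ = s≤s z≤n
𝟙-∨ false _ = ≤-refl

card : ∀ {n} → (Fin n → Bool) → ℕ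
card {n} p = ∑[ i < n ] 𝟙 (p i)

∧-true : ∀ {a b} → a ∧ b ≡ true → a ≡ true × b ≡ true
∧-true {true} b≡true = refl , b≡true

eqB-refl : ∀ {n} (u : Fin n) → eqB u u ≡ true
eqB-refl u = dec-true (u ≟ u) refl

eqB-≢ : ∀ {n} {u v : Fin n} → u ≢ v → eqB u v ≡ false
eqB-≢ {u = u} {v} = dec-false (u ≟ v)

sum-mono-≤ : ∀ {n} {f g : Fin n → ℕ} → (∀ i → f i ≤ g i) → sum f ≤ sum g
sum-mono-≤ {zero}  _   = z≤n
sum-mono-≤ {suc n} f≤g = +-mono-≤ (f≤g zero) (sum-mono-≤ (f≤g ∘ suc))

sum-mono-< : ∀ {n} {f g : Fin n → ℕ} → (∀ i → f i ≤ g i) → ∀ j → f j < g j → sum f < sum g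
sum-mono-< f≤g zero    fj<gj = +-mono-<-≤ fj<gj (sum-mono-≤ (f≤g ∘ suc))
sum-mono-< f≤g (suc j) fj<gj = +-mono-≤-< (f≤g zero) (sum-mono-< (f≤g ∘ suc) j fj<gj)

term≤sum : ∀ {n} (f : Fin n → ℕ) i → f i ≤ sum f
term≤sum f zero    = m≤m+n _ _
term≤sum f (suc i) = ≤-trans (term≤sum (f ∘ suc) i) (m≤n+m _ _)

two-terms≤sum : ∀ {n} (f : Fin n → ℕ) {i j} → i ≢ j → f i + f j ≤ sum f
two-terms≤sum f {zero}  {zero}  i≢j = contradiction refl i≢j
two-terms≤sum f {zero}  {suc j} _   = +-monoʳ-≤ (f zero) (term≤sum (f ∘ suc) j)
two-terms≤sum f {suc i} {zero}  _   =
  ≤-trans (≤-reflexive (+-comm (f (suc i)) (f zero))) (+-monoʳ-≤ (f zero) (term≤sum (f ∘ suc) i))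
two-terms≤sum f {suc i} {suc j} i≢j =
  ≤-trans (two-terms≤sum (f ∘ suc) (i≢j ∘ cong suc)) (m≤n+m _ (f zero))

sum-zero : ∀ {n} {f : Fin n → ℕ} → (∀ i → f i ≡ 0) → sum f ≡ 0
sum-zero {n} f≡0 = trans (sum-cong-≗ f≡0) (sum-replicate-zero n)

sum-const : ∀ n c → ∑[ i < n ] c ≡ n * c
sum-const zero    c = refl
sum-const (suc n) c = cong (c +_) (sum-const n c)

sum-2* : ∀ {n} (f : Fin n → ℕ) → ∑[ i < n ] (2 * f i) ≡ 2 * sum f
sum-2* f = sym (*-distribˡ-sum 2 f)

sum-at : ∀ {n} {f : Fin n → ℕ} j → (∀ i → i ≢ j → f i ≡ 0) → sum f ≡ f j
sum-at {f = f} zero    off = trans (cong (f zero +_) (sum-zero (λ i → off (suc i) λ ()))) (+-identityʳ _)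
sum-at {f = f} (suc j) off = trans (cong (_+ sum (f ∘ suc)) (off zero λ ()))
                                   (sum-at j (λ i i≢j → off (suc i) (i≢j ∘ Finₚ.suc-injective)))

sum-select : ∀ {n} (f : Fin n → ℕ) j → ∑[ i < n ] (if eqB i j then f i else 0) ≡ f j
sum-select f j =
  trans (sum-at j (λ i i≢j → cong (λ b → if b then f i else 0) (eqB-≢ i≢j)))
        (cong (λ b → if b then f j else 0) (eqB-refl j))

1≤card : ∀ {n} (p : Fin n → Bool) i → p i ≡ true → 1 ≤ card p
1≤card p i pi = ≤-trans (≤-reflexive (cong 𝟙 (sym pi))) (term≤sum (𝟙 ∘ p) i)

card≤1 : ∀ {n} (p : Fin n → Bool) → (∀ i j → p i ≡ true → p j ≡ true → i ≡ j) → card p ≤ 1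
card≤1 p unique with Finₚ.any? (λ i → p i Bool.≟ true)
... | yes (i , pi) = ≤-trans (≤-reflexive (sum-at i off)) (𝟙≤1 (p i))
  where
  off : ∀ j → j ≢ i → 𝟙 (p j) ≡ 0
  off j j≢i with p j in pj
  ... | true  = contradiction (unique j i pj pi) j≢i
  ... | false = refl
... | no none = ≤-trans (≤-reflexive (sum-zero off)) z≤n
  where
  off : ∀ j → 𝟙 (p j) ≡ 0
  off j with p j in pj
  ... | true  = contradiction (j , pj) none
  ... | false = refl

card-cong : ∀ {n} {p q : Fin n → Bool} → (∀ i → p i ≡ q i) → card p ≡ card q
card-cong p≡q = sum-cong-≗ (cong 𝟙 ∘ p≡q)

card-∨ : ∀ {n} (p q : Fin n → Bool) → card (λ i → p i ∨ q i) ≤ card p + card q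
card-∨ p q =
  ≤-trans (sum-mono-≤ (λ i → 𝟙-∨ (p i) (q i))) (≤-reflexive (∑-distrib-+ (𝟙 ∘ p) (𝟙 ∘ q)))

count-tabulate : ∀ {A : Set} {n} (p : A → Bool) (f : Fin n → A) →
                 count p (tabulate f) ≡ ∑[ i < n ] 𝟙 (p (f i))
count-tabulate {n = zero}  p f = refl
count-tabulate {n = suc n} p f = cong (𝟙 (p (f zero)) +_) (count-tabulate p (f ∘ suc))

count-allFin : ∀ {n} (p : Fin n → Bool) → count p (allFin n) ≡ card p
count-allFin p = count-tabulate p (λ i → i)

size≡card : ∀ {n} (S : VSet n) → size S ≡ card S
size≡card = count-allFin

deg≡card : ∀ {n} (R : EdgeRel n) u → deg R u ≡ card (R u)
deg≡card R u = count-allFin (R u)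

listSum-allFin : ∀ {n} (f : Fin n → ℕ) → ℕ-List.sum (map f (allFin n)) ≡ sum f
listSum-allFin {n} f = trans (cong ℕ-List.sum (map-tabulate (λ i → i) f)) (sum-tabulate f)
  where
  sum-tabulate : ∀ {m} (g : Fin m → ℕ) → ℕ-List.sum (tabulate g) ≡ sum g
  sum-tabulate {zero}  g = refl
  sum-tabulate {suc m} g = cong (g zero +_) (sum-tabulate (g ∘ suc))

𝟙-any≤count : ∀ {A : Set} (p : A → Bool) xs → 𝟙 (any p xs) ≤ count p xs
𝟙-any≤count p []       = z≤n
𝟙-any≤count p (x ∷ xs) with p x
... | true  = s≤s z≤n
... | false = 𝟙-any≤count p xs

count-none : ∀ {A : Set} (p : A → Bool) xs → any p xs ≡ false → count p xs ≡ 0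
count-none p []       _    = refl
count-none p (x ∷ xs) none with p x
... | false = count-none p xs none

ascending : ∀ {n} → EdgeRel n → EdgeRel n
ascending R u w = (toℕ u <ᵇ toℕ w) ∧ R u w

numEdges≡sum : ∀ {n} (R : EdgeRel n) → numEdges R ≡ ∑[ u < n ] card (ascending R u)
numEdges≡sum {n} R =
  trans (listSum-allFin (λ u → count (ascending R u) (allFin n)))
        (sum-cong-≗ (count-allFin ∘ ascending R))

numEdges-cong : ∀ {n} {R R' : EdgeRel n} → (∀ u w → R u w ≡ R' u w) → numEdges R ≡ numEdges R'
numEdges-cong {R = R} {R'} R≡R' = begin
  numEdges R                          ≡⟨ numEdges≡sum R ⟩
  sum (λ u → card (ascending R u))    ≡⟨ sum-cong-≗ (λ u → card-cong (λ w → cong (_ ∧_) (R≡R' u w))) ⟩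
  sum (λ u → card (ascending R' u))   ≡⟨ numEdges≡sum R' ⟨
  numEdges R'                         ∎
  where open ≡-Reasoning

numEdges-empty : ∀ {n} → numEdges {n} (λ _ _ → false) ≡ 0
numEdges-empty {n} = trans (numEdges≡sum {n} (λ _ _ → false))
  (sum-zero {n} (λ u → sum-zero {n} (λ w → cong 𝟙 (Bool.∧-zeroʳ (toℕ u <ᵇ toℕ w)))))

numEdges-∨ : ∀ {n} (R R' : EdgeRel n) → numEdges (λ u w → R u w ∨ R' u w) ≤ numEdges R + numEdges R'
numEdges-∨ R R' = begin
  numEdges (λ u w → R u w ∨ R' u w)
    ≡⟨ numEdges≡sum (λ u w → R u w ∨ R' u w) ⟩
  sum (λ u → card (ascending (λ u w → R u w ∨ R' u w) u))
    ≡⟨ sum-cong-≗ (λ u → card-cong (λ w → Bool.∧-distribˡ-∨ _ (R u w) (R' u w))) ⟩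
  sum (λ u → card (λ w → ascending R u w ∨ ascending R' u w))
    ≤⟨ sum-mono-≤ (λ u → card-∨ (ascending R u) (ascending R' u)) ⟩
  sum (λ u → card (ascending R u) + card (ascending R' u))
    ≡⟨ ∑-distrib-+ (card ∘ ascending R) (card ∘ ascending R') ⟩
  sum (λ u → card (ascending R u)) + sum (λ u → card (ascending R' u))
    ≡⟨ cong₂ _+_ (numEdges≡sum R) (numEdges≡sum R') ⟨
  numEdges R + numEdges R'
    ∎
  where open ≤-Reasoning

numEdges-any : ∀ {A : Set} {n} (φ : A → EdgeRel n) xs →
               numEdges (λ u w → any (λ a → φ a u w) xs) ≤ ℕ-List.sum (map (numEdges ∘ φ) xs)
numEdges-any {n = n} φ []       = ≤-reflexive (numEdges-empty {n})
numEdges-any         φ (a ∷ xs) =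
  ≤-trans (numEdges-∨ (φ a) (λ u w → any (λ b → φ b u w) xs)) (+-monoʳ-≤ _ (numEdges-any φ xs))

numEdges-arc : ∀ {n} (x y : Fin n) → numEdges (λ u w → eqB x u ∧ eqB y w) ≡ 𝟙 (toℕ x <ᵇ toℕ y)
numEdges-arc {n} x y = begin
  numEdges (λ u w → eqB x u ∧ eqB y w)                    ≡⟨ numEdges≡sum (λ u w → eqB x u ∧ eqB y w) ⟩
  sum (λ u → card (λ w → lt u w ∧ (eqB x u ∧ eqB y w)))   ≡⟨ sum-at x off-x ⟩
  card (λ w → lt x w ∧ (eqB x x ∧ eqB y w))               ≡⟨ sum-at y off-y ⟩
  𝟙 (lt x y ∧ (eqB x x ∧ eqB y y))                         ≡⟨ cong 𝟙 at-xy ⟩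
  𝟙 (lt x y)                                               ∎
  where
  open ≡-Reasoning
  lt : Fin n → Fin n → Bool
  lt u w = toℕ u <ᵇ toℕ w
  off-x : ∀ u → u ≢ x → card (λ w → lt u w ∧ (eqB x u ∧ eqB y w)) ≡ 0
  off-x u u≢x rewrite eqB-≢ (u≢x ∘ sym) = sum-zero (λ w → cong 𝟙 (Bool.∧-zeroʳ (lt u w)))
  off-y : ∀ w → w ≢ y → 𝟙 (lt x w ∧ (eqB x x ∧ eqB y w)) ≡ 0
  off-y w w≢y rewrite eqB-≢ (w≢y ∘ sym) =
    cong 𝟙 (trans (cong (lt x w ∧_) (Bool.∧-zeroʳ (eqB x x))) (Bool.∧-zeroʳ (lt x w)))
  at-xy : lt x y ∧ (eqB x x ∧ eqB y y) ≡ lt x y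
  at-xy rewrite eqB-refl x | eqB-refl y = Bool.∧-identityʳ (lt x y)

𝟙<ᵇ+𝟙>ᵇ≤1 : ∀ a b → 𝟙 (a <ᵇ b) + 𝟙 (b <ᵇ a) ≤ 1
𝟙<ᵇ+𝟙>ᵇ≤1 a b with a <ᵇ b | <ᵇ-reflects-< a b | b <ᵇ a | <ᵇ-reflects-< b a
... | true  | ofʸ a<b | true  | ofʸ b<a = contradiction b<a (<-asym a<b)
... | true  | _       | false | _       = ≤-refl
... | false | _       | b<ᵇa  | _       = 𝟙≤1 b<ᵇa

numEdges-edgeIn : ∀ {n} (p : List (Fin n)) → numEdges (λ u w → edgeIn u w p) ≤ pathLen p
numEdges-edgeIn {n} []          = ≤-reflexive (numEdges-empty {n})
numEdges-edgeIn {n} (x ∷ [])    = ≤-reflexive (numEdges-empty {n})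
numEdges-edgeIn {n} (x ∷ y ∷ p) = begin
  numEdges (λ u w → edgeIn u w (x ∷ y ∷ p))
    ≤⟨ numEdges-∨ (λ u w → eqB x u ∧ eqB y w) _ ⟩
  numEdges (λ u w → eqB x u ∧ eqB y w) + numEdges (λ u w → (eqB x w ∧ eqB y u) ∨ rest u w)
    ≤⟨ +-monoʳ-≤ _ (numEdges-∨ (λ u w → eqB x w ∧ eqB y u) rest) ⟩
  numEdges (λ u w → eqB x u ∧ eqB y w) + (numEdges (λ u w → eqB x w ∧ eqB y u) + numEdges rest)
    ≡⟨ cong₂ (λ a b → a + (b + numEdges rest)) (numEdges-arc x y)
             (trans (numEdges-cong (λ u w → Bool.∧-comm (eqB x w) (eqB y u))) (numEdges-arc y x)) ⟩
  𝟙 (toℕ x <ᵇ toℕ y) + (𝟙 (toℕ y <ᵇ toℕ x) + numEdges rest)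
    ≡⟨ +-assoc (𝟙 (toℕ x <ᵇ toℕ y)) _ _ ⟨
  𝟙 (toℕ x <ᵇ toℕ y) + 𝟙 (toℕ y <ᵇ toℕ x) + numEdges rest
    ≤⟨ +-mono-≤ (𝟙<ᵇ+𝟙>ᵇ≤1 (toℕ x) (toℕ y)) (numEdges-edgeIn (y ∷ p)) ⟩
  1 + pathLen (y ∷ p)
    ∎
  where
  open ≤-Reasoning
  rest : EdgeRel n
  rest u w = edgeIn u w (y ∷ p)

degreeSum≤2*numEdges : ∀ {n} (R : EdgeRel n) → (∀ u w → R u w ≡ R w u) → (∀ u → R u u ≡ false) →
                       ∑[ u < n ] deg R u ≤ 2 * numEdges R
degreeSum≤2*numEdges {n} R R-sym R-irrefl = begin
  sum (deg R)
    ≡⟨ sum-cong-≗ (deg≡card R) ⟩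
  sum (λ u → card (R u))
    ≤⟨ sum-mono-≤ (λ u → sum-mono-≤ (split u)) ⟩
  sum (λ u → sum (λ w → 𝟙 (ascending R u w) + 𝟙 (ascending R w u)))
    ≡⟨ sum-cong-≗ (λ u → ∑-distrib-+ (𝟙 ∘ ascending R u) (λ w → 𝟙 (ascending R w u))) ⟩
  sum (λ u → card (ascending R u) + sum (λ w → 𝟙 (ascending R w u)))
    ≡⟨ ∑-distrib-+ (card ∘ ascending R) (λ u → sum (λ w → 𝟙 (ascending R w u))) ⟩
  sum (λ u → card (ascending R u)) + sum (λ u → sum (λ w → 𝟙 (ascending R w u)))
    ≡⟨ cong (sum (card ∘ ascending R) +_) (∑-comm (λ u w → 𝟙 (ascending R w u))) ⟩
  sum (λ u → card (ascending R u)) + sum (λ u → card (ascending R u))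
    ≡⟨ cong₂ _+_ (numEdges≡sum R) (numEdges≡sum R) ⟨
  numEdges R + numEdges R
    ≡⟨ cong (numEdges R +_) (+-identityʳ (numEdges R)) ⟨
  2 * numEdges R
    ∎
  where
  open ≤-Reasoning
  split : ∀ u w → 𝟙 (R u w) ≤ 𝟙 (ascending R u w) + 𝟙 (ascending R w u)
  split u w with toℕ u <ᵇ toℕ w | <ᵇ-reflects-< (toℕ u) (toℕ w)
               | toℕ w <ᵇ toℕ u | <ᵇ-reflects-< (toℕ w) (toℕ u)
  ... | true  | _       | _     | _       = m≤m+n _ _
  ... | false | _       | true  | _       = ≤-reflexive (cong 𝟙 (R-sym u w))
  ... | false | ofⁿ u≮w | false | ofⁿ w≮u
    rewrite Finₚ.toℕ-injective (≤-antisym (≮⇒≥ w≮u) (≮⇒≥ u≮w)) | R-irrefl w = z≤n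

-- Forests

record IsForestOn {n} (T : EdgeRel n) (S : VSet n) : Set where
  field
    symmetric   : ∀ u w → T u w ≡ T w u
    irreflexive : ∀ u → T u u ≡ false
    acyclic     : Acyclic T
    supported   : ∀ u w → T u w ≡ true → S u ≡ true

Unique-++⁻ˡ : ∀ {A : Set} (xs : List A) {ys} → Unique (xs ++ ys) → Unique xs
Unique-++⁻ˡ []       _             = []
Unique-++⁻ˡ (x ∷ xs) (x∉ ∷ unique) = All.++⁻ˡ xs x∉ ∷ Unique-++⁻ˡ xs unique

Chain-close : ∀ {n} {R : EdgeRel n} xs w {ys} c → Chain R (xs ++ w ∷ ys) → R w c ≡ true →
              Chain R (xs ++ w ∷ c ∷ [])
Chain-close []            w {[]}    c _              Rwc = Rwc , tt
Chain-close []            w {_ ∷ _} c _              Rwc = Rwc , tt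
Chain-close (x ∷ [])      w         c (Rxw , chain)  Rwc = Rxw , Chain-close [] w c chain Rwc
Chain-close (x ∷ x' ∷ xs) w         c (Rxx' , chain) Rwc = Rxx' , Chain-close (x' ∷ xs) w c chain Rwc

Chain-mono : ∀ {n} {R R' : EdgeRel n} → (∀ u w → R u w ≡ true → R' u w ≡ true) →
             ∀ xs → Chain R xs → Chain R' xs
Chain-mono R⇒R' []           _             = tt
Chain-mono R⇒R' (x ∷ [])     _             = tt
Chain-mono R⇒R' (x ∷ y ∷ xs) (Rxy , chain) = R⇒R' x y Rxy , Chain-mono R⇒R' (y ∷ xs) chain

Acyclic-mono : ∀ {n} {R R' : EdgeRel n} → (∀ u w → R u w ≡ true → R' u w ≡ true) →
               Acyclic R' → Acyclic R
Acyclic-mono R⇒R' acyclic v vs (long , unique , chain) =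
  acyclic v vs (long , unique , Chain-mono R⇒R' _ chain)

another-neighbour : ∀ {n} (R : EdgeRel n) u → 2 ≤ deg R u → ∀ p → ∃[ w ] (R u w ≡ true × w ≢ p)
another-neighbour R u 2≤deg p with Finₚ.any? (λ w → (R u w Bool.≟ true) ×-dec ¬? (w ≟ p))
... | yes found = found
... | no  none  =
  contradiction (≤-trans 2≤deg (≤-reflexive (deg≡card R u))) (≤⇒≯ (card≤1 (R u) same))
  where
  is-p : ∀ w → R u w ≡ true → w ≡ p
  is-p w Ruw with w ≟ p
  ... | yes w≡p = w≡p
  ... | no  w≢p = contradiction (w , Ruw , w≢p) none
  same : ∀ i j → R u i ≡ true → R u j ≡ true → i ≡ j
  same i j Rui Ruj = trans (is-p i Rui) (sym (is-p j Ruj))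

module _ {n} {T : EdgeRel n} {S : VSet n} (forest : IsForestOn T S) where
  open IsForestOn forest
  open import Data.List.Membership.DecPropositional (_≟_ {n}) using (_∉_; _∈?_)

  unvisited : List (Fin n) → ℕ
  unvisited vs = card (λ y → not (does (y ∈? vs)))

  unvisited-∷ : ∀ w vs → w ∉ vs → unvisited (w ∷ vs) < unvisited vs
  unvisited-∷ w vs w∉vs = sum-mono-< fewer w at-w
    where
    fewer : ∀ y → 𝟙 (not (does (y ∈? w ∷ vs))) ≤ 𝟙 (not (does (y ∈? vs)))
    fewer y with does (y ≟ w)
    ... | true  = z≤n
    ... | false = ≤-refl
    at-w : 𝟙 (not (does (w ∈? w ∷ vs))) < 𝟙 (not (does (w ∈? vs)))
    at-w rewrite eqB-refl w | dec-false (w ∈? vs) w∉vs = ≤-refl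

  previous : Fin n → List (Fin n) → Fin n
  previous cur []      = cur
  previous cur (r ∷ _) = r

  -- Walks are kept reversed, current vertex first; stepping back onto an earlier vertex other
  -- than the previous one would close a cycle.
  no-return : ∀ cur rest → Unique (cur ∷ rest) → Chain T (cur ∷ rest) →
              ∀ w → T cur w ≡ true → w ≢ previous cur rest → w ∉ cur ∷ rest
  no-return cur rest _ _ w Tcw _ (here refl) with () ← trans (sym Tcw) (irreflexive cur)
  no-return cur (r ∷ rest) _ _ w _ w≢r (there (here refl)) = w≢r refl
  no-return cur (r ∷ rest) unique chain w Tcw _ (there (there w∈rest))
    with pre , suf , refl ← ∈-∃++ w∈rest =
    acyclic cur (r ∷ pre ++ w ∷ []) (s≤s (length-snoc pre) , cycle-unique , cycle-chain)
    where
    length-snoc : ∀ xs → 1 ≤ length (xs ++ w ∷ [])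
    length-snoc []      = s≤s z≤n
    length-snoc (_ ∷ _) = s≤s z≤n
    cycle-unique : Unique (cur ∷ r ∷ pre ++ w ∷ [])
    cycle-unique = Unique-++⁻ˡ (cur ∷ r ∷ pre ++ w ∷ [])
      (subst Unique (cong (λ z → cur ∷ r ∷ z) (sym (++-assoc pre (w ∷ []) suf))) unique)
    cycle-chain : Chain T (cur ∷ (r ∷ pre ++ w ∷ []) ++ cur ∷ [])
    cycle-chain = subst (Chain T) (cong (λ z → cur ∷ r ∷ z) (sym (++-assoc pre (w ∷ []) (cur ∷ []))))
      (Chain-close (cur ∷ r ∷ pre) w cur chain (trans (symmetric w cur) Tcw))

  minDegree≥2⇒empty : (∀ v → S v ≡ true → 2 ≤ deg T v) → ∀ v → S v ≡ true → ⊥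
  minDegree≥2⇒empty deg≥2 v Sv = walk (suc (unvisited (v ∷ []))) v [] ([] ∷ []) tt Sv ≤-refl
    where
    walk : ∀ m cur rest → Unique (cur ∷ rest) → Chain T (cur ∷ rest) → S cur ≡ true →
           unvisited (cur ∷ rest) < m → ⊥
    walk zero _ _ _ _ _ ()
    walk (suc m) cur rest unique chain Scur fuel
      with w , Tcw , w≢prev ← another-neighbour T cur (deg≥2 cur Scur) (previous cur rest)
      with w ∈? cur ∷ rest
    ... | yes w∈ = no-return cur rest unique chain w Tcw w≢prev w∈
    ... | no  w∉ =
      walk m w (cur ∷ rest) (All.¬Any⇒All¬ _ w∉ ∷ unique) (Twc , chain) (supported w cur Twc)
           (<-≤-trans (unvisited-∷ w (cur ∷ rest) w∉) (s≤s⁻¹ fuel))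
      where
      Twc : T w cur ≡ true
      Twc = trans (symmetric w cur) Tcw

  leaf : ∀ v → S v ≡ true → ∃[ u ] (S u ≡ true × deg T u ≤ 1)
  leaf v Sv with Finₚ.any? (λ u → (S u Bool.≟ true) ×-dec (deg T u ≤? 1))
  ... | yes found = found
  ... | no  none  = ⊥-elim (minDegree≥2⇒empty deg≥2 v Sv)
    where
    deg≥2 : ∀ u → S u ≡ true → 2 ≤ deg T u
    deg≥2 u Su with deg T u ≤? 1
    ... | yes deg≤1 = contradiction (u , Su , deg≤1) none
    ... | no  deg≰1 = ≰⇒> deg≰1

deleteVertex : ∀ {n} → Fin n → EdgeRel n → EdgeRel n
deleteVertex v T u w = T u w ∧ not (eqB u v) ∧ not (eqB w v)

IsForestOn-deleteVertex : ∀ {n} {T : EdgeRel n} {S} → IsForestOn T S → ∀ v →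
                          IsForestOn (deleteVertex v T) (removeV v S)
IsForestOn-deleteVertex {T = T} {S} forest v = record
  { symmetric   = λ u w → cong₂ _∧_ (symmetric u w) (Bool.∧-comm (not (eqB u v)) (not (eqB w v)))
  ; irreflexive = λ u → cong (_∧ _) (irreflexive u)
  ; acyclic     = Acyclic-mono (λ u w → proj₁ ∘ ∧-true) acyclic
  ; supported   = supported′
  }
  where
  open IsForestOn forest
  supported′ : ∀ u w → deleteVertex v T u w ≡ true → removeV v S u ≡ true
  supported′ u w T'uw with Tuw , u≢v∧w≢v ← ∧-true T'uw =
    cong₂ _∧_ (supported u w Tuw) (proj₁ (∧-true u≢v∧w≢v))

card-removeV : ∀ {n} (S : VSet n) v → S v ≡ true → card S ≡ card (removeV v S) + 1
card-removeV {n} S v Sv = begin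
  card S
    ≡⟨ sum-cong-≗ split ⟩
  sum (λ w → 𝟙 (removeV v S w) + (if eqB w v then 1 else 0))
    ≡⟨ ∑-distrib-+ (𝟙 ∘ removeV v S) _ ⟩
  card (removeV v S) + sum (λ w → if eqB w v then 1 else 0)
    ≡⟨ cong (card (removeV v S) +_) (sum-select (λ _ → 1) v) ⟩
  card (removeV v S) + 1
    ∎
  where
  open ≡-Reasoning
  split : ∀ w → 𝟙 (S w) ≡ 𝟙 (removeV v S w) + (if eqB w v then 1 else 0)
  split w with w ≟ v
  ... | yes refl rewrite Sv = refl
  ... | no  _    rewrite Bool.∧-identityʳ (S w) = sym (+-identityʳ _)

deg-deleteVertex : ∀ {n} (T : EdgeRel n) v u →
                   deg T u ≤ deg (deleteVertex v T) u + (if eqB u v then deg T u else 0) + 𝟙 (T u v)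
deg-deleteVertex {n} T v u = begin
  deg T u
    ≡⟨ deg≡card T u ⟩
  card (T u)
    ≤⟨ sum-mono-≤ split ⟩
  sum (λ w → 𝟙 (T' u w) + (if eqB u v then 𝟙 (T u w) else 0) + (if eqB w v then 𝟙 (T u w) else 0))
    ≡⟨ trans (∑-distrib-+ (λ w → 𝟙 (T' u w) + (if eqB u v then 𝟙 (T u w) else 0)) _)
             (cong₂ _+_ (∑-distrib-+ (𝟙 ∘ T' u) _) (sum-select (𝟙 ∘ T u) v)) ⟩
  card (T' u) + sum (λ w → if eqB u v then 𝟙 (T u w) else 0) + 𝟙 (T u v)
    ≡⟨ cong₂ (λ a b → a + b + 𝟙 (T u v)) (deg≡card T' u) pull-if ⟨
  deg T' u + (if eqB u v then deg T u else 0) + 𝟙 (T u v)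
    ∎
  where
  open ≤-Reasoning
  T' : EdgeRel n
  T' = deleteVertex v T
  split : ∀ w → 𝟙 (T u w) ≤ 𝟙 (T' u w) + (if eqB u v then 𝟙 (T u w) else 0)
                                        + (if eqB w v then 𝟙 (T u w) else 0)
  split w with T u w | eqB u v | eqB w v
  ... | false | _     | _     = z≤n
  ... | true  | false | false = s≤s z≤n
  ... | true  | false | true  = s≤s z≤n
  ... | true  | true  | _     = s≤s z≤n
  pull-if : (if eqB u v then deg T u else 0) ≡ sum (λ w → if eqB u v then 𝟙 (T u w) else 0)
  pull-if with eqB u v
  ... | true  = deg≡card T u
  ... | false = sym (sum-zero {n} (λ _ → refl))

degreeSum-deleteVertex : ∀ {n} (T : EdgeRel n) → (∀ u w → T u w ≡ T w u) → ∀ v →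
                         ∑[ u < n ] deg T u ≤ ∑[ u < n ] deg (deleteVertex v T) u + 2 * deg T v
degreeSum-deleteVertex {n} T T-sym v = begin
  sum (deg T)
    ≤⟨ sum-mono-≤ (deg-deleteVertex T v) ⟩
  sum (λ u → deg T' u + (if eqB u v then deg T u else 0) + 𝟙 (T u v))
    ≡⟨ trans (∑-distrib-+ (λ u → deg T' u + (if eqB u v then deg T u else 0)) (λ u → 𝟙 (T u v)))
             (cong (_+ card (λ u → T u v)) (∑-distrib-+ (deg T') _)) ⟩
  sum (deg T') + sum (λ u → if eqB u v then deg T u else 0) + card (λ u → T u v)
    ≡⟨ cong₂ (λ a b → sum (deg T') + a + b) (sum-select (deg T) v)
             (trans (card-cong (λ u → T-sym u v)) (sym (deg≡card T v))) ⟩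
  sum (deg T') + deg T v + deg T v
    ≡⟨ +-assoc (sum (deg T')) (deg T v) (deg T v) ⟩
  sum (deg T') + (deg T v + deg T v)
    ≡⟨ cong (λ d → sum (deg T') + (deg T v + d)) (+-identityʳ (deg T v)) ⟨
  sum (deg T') + 2 * deg T v
    ∎
  where
  open ≤-Reasoning
  T' : EdgeRel n
  T' = deleteVertex v T

degreeSum+2≤2*card : ∀ {n} {T : EdgeRel n} {S} → IsForestOn T S → ∀ v → S v ≡ true →
                     ∑[ u < n ] deg T u + 2 ≤ 2 * card S
degreeSum+2≤2*card {S = S} = go (card S) refl
  where
  go : ∀ {n} m {T : EdgeRel n} {S} → card S ≡ m → IsForestOn T S → ∀ v → S v ≡ true →
       ∑[ u < n ] deg T u + 2 ≤ 2 * card S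
  go zero {S = S} card≡0 _ v Sv = contradiction card≡0 (>⇒≢ (1≤card S v Sv))
  go {n} (suc m) {T} {S} card≡1+m forest v Sv
    with ℓ , Sℓ , degℓ≤1 ← leaf forest v Sv
    with Finₚ.any? (λ u → removeV ℓ S u Bool.≟ true)
  ... | yes (u , S′u) = begin
    sum (deg T) + 2                   ≤⟨ +-monoˡ-≤ 2 (degreeSum-deleteVertex T symmetric ℓ) ⟩
    sum (deg T′) + 2 * deg T ℓ + 2    ≤⟨ +-monoˡ-≤ 2 (+-monoʳ-≤ (sum (deg T′)) (*-monoʳ-≤ 2 degℓ≤1)) ⟩
    sum (deg T′) + 2 + 2              ≤⟨ +-monoˡ-≤ 2 (go m card′≡m forest′ u S′u) ⟩
    2 * card (removeV ℓ S) + 2        ≡⟨ *-distribˡ-+ 2 (card (removeV ℓ S)) 1 ⟨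
    2 * (card (removeV ℓ S) + 1)      ≡⟨ cong (2 *_) (card-removeV S ℓ Sℓ) ⟨
    2 * card S                        ∎
    where
    open ≤-Reasoning
    open IsForestOn forest
    T′ : EdgeRel n
    T′ = deleteVertex ℓ T
    forest′ : IsForestOn T′ (removeV ℓ S)
    forest′ = IsForestOn-deleteVertex forest ℓ
    card′≡m : card (removeV ℓ S) ≡ m
    card′≡m = suc-injective (trans (trans (+-comm 1 _) (sym (card-removeV S ℓ Sℓ))) card≡1+m)
  ... | no none = begin
    sum (deg T) + 2  ≡⟨ cong (_+ 2) (sum-zero no-degree) ⟩
    2                ≤⟨ *-monoʳ-≤ 2 (1≤card S v Sv) ⟩
    2 * card S       ∎
    where
    open ≤-Reasoning
    open IsForestOn forest
    only-ℓ : ∀ u → S u ≡ true → u ≡ ℓ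
    only-ℓ u Su with u ≟ ℓ
    ... | yes u≡ℓ = u≡ℓ
    ... | no  u≢ℓ = contradiction (u , S′u) none
      where
      S′u : removeV ℓ S u ≡ true
      S′u = trans (cong (λ b → S u ∧ not b) (eqB-≢ u≢ℓ)) (trans (Bool.∧-identityʳ (S u)) Su)
    edgeless : ∀ u w → T u w ≡ false
    edgeless u w with T u w in Tuw
    ... | false = refl
    ... | true with only-ℓ u (supported u w Tuw) | only-ℓ w (supported w u (trans (symmetric w u) Tuw))
    ...   | refl | refl = trans (sym Tuw) (irreflexive u)
    no-degree : ∀ u → deg T u ≡ 0
    no-degree u = trans (deg≡card T u) (sum-zero (cong 𝟙 ∘ edgeless u))

-- Paths between terminals

edgeIn-head : ∀ {n} (u w : Fin n) p → edgeIn u w (u ∷ w ∷ p) ≡ true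
edgeIn-head u w p rewrite eqB-refl u | eqB-refl w = refl

edgeIn-head⁻¹ : ∀ {n} (u w : Fin n) p → edgeIn w u (u ∷ w ∷ p) ≡ true
edgeIn-head⁻¹ u w p rewrite eqB-refl u | eqB-refl w = Bool.∨-zeroʳ _

edgeIn-∷ : ∀ {n} {u w : Fin n} x p → edgeIn u w p ≡ true → edgeIn u w (x ∷ p) ≡ true
edgeIn-∷ {u = u} {w} x (y ∷ p) e rewrite e =
  trans (cong ((eqB x u ∧ eqB y w) ∨_) (Bool.∨-zeroʳ (eqB x w ∧ eqB y u)))
        (Bool.∨-zeroʳ (eqB x u ∧ eqB y w))

after : ∀ {n} → List (Fin n) → Fin n → Fin n
after []      b = b
after (m ∷ _) b = m

before : ∀ {n} → Fin n → List (Fin n) → Fin n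
before a []        = a
before a (m ∷ mid) = before m mid

module _ {n} {T : EdgeRel n} where

  first-edge : ∀ a mid b → Chain T (a ∷ mid ++ b ∷ []) →
               T a (after mid b) ≡ true × edgeIn a (after mid b) (a ∷ mid ++ b ∷ []) ≡ true
  first-edge a []        b (Tab , _) = Tab , edgeIn-head a b []
  first-edge a (m ∷ mid) b (Tam , _) = Tam , edgeIn-head a m (mid ++ b ∷ [])

  last-edge : ∀ a mid b → Chain T (a ∷ mid ++ b ∷ []) →
              T (before a mid) b ≡ true × edgeIn b (before a mid) (a ∷ mid ++ b ∷ []) ≡ true
  last-edge a []        b (Tab , _)   = Tab , edgeIn-head⁻¹ a b []
  last-edge a (m ∷ mid) b (_ , chain) =
    let T-edge , edge = last-edge m mid b chain in T-edge , edgeIn-∷ a (m ∷ mid ++ b ∷ []) edge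

degreeSumOn : ∀ {n} → EdgeRel n → VSet n → ℕ
degreeSumOn {n} T C = ∑[ u < n ] (if C u then deg T u else 0)

module _ {n} {T : EdgeRel n} {C : VSet n} (T-sym : ∀ u w → T u w ≡ T w u) where

  terminalDart : List (Fin n) → EdgeRel n
  terminalDart p u w = (C u ∧ T u w) ∧ edgeIn u w p

  2≤terminalDarts : ∀ p → IsCPath T C p → 2 ≤ ∑[ u < n ] card (terminalDart p u)
  2≤terminalDarts p (a∉ ∷ _ , chain , a , mid , b , refl , Ca , Cb , _) =
    ≤-trans (+-mono-≤ (1≤card (terminalDart p a) (after mid b) dart-a)
                      (1≤card (terminalDart p b) (before a mid) dart-b))
            (two-terms≤sum (card ∘ terminalDart p) a≢b)
    where
    dart : ∀ {u w} → C u ≡ true → T u w ≡ true → edgeIn u w p ≡ true → terminalDart p u w ≡ true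
    dart Cu Tuw edge rewrite Cu | Tuw | edge = refl
    dart-a : terminalDart p a (after mid b) ≡ true
    dart-a = let T-edge , edge = first-edge a mid b chain in dart Ca T-edge edge
    dart-b : terminalDart p b (before a mid) ≡ true
    dart-b = let T-edge , edge = last-edge a mid b chain in dart Cb (trans (T-sym b _) T-edge) edge
    a≢b : a ≢ b
    a≢b with a≢b ∷ [] ← All.++⁻ʳ mid a∉ = a≢b

  2*pathCount≤degreeSumOn : ∀ x (P : Fin x → List (Fin n)) → (∀ i → IsCPath T C (P i)) →
    (∀ u w i i' → edgeIn u w (P i) ≡ true → edgeIn u w (P i') ≡ true → i ≡ i') →
    2 * x ≤ degreeSumOn T C
  2*pathCount≤degreeSumOn x P paths disjoint = begin
    2 * x
      ≡⟨ trans (sum-const x 2) (*-comm x 2) ⟨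
    ∑[ i < x ] 2
      ≤⟨ sum-mono-≤ (λ i → 2≤terminalDarts (P i) (paths i)) ⟩
    ∑[ i < x ] ∑[ u < n ] ∑[ w < n ] 𝟙 (terminalDart (P i) u w)
      ≡⟨ trans (∑-comm (λ i u → card (terminalDart (P i) u)))
               (sum-cong-≗ (λ u → ∑-comm (λ i w → 𝟙 (terminalDart (P i) u w)))) ⟩
    ∑[ u < n ] ∑[ w < n ] ∑[ i < x ] 𝟙 (terminalDart (P i) u w)
      ≤⟨ sum-mono-≤ (λ u → sum-mono-≤ (at-most-one-path u)) ⟩
    ∑[ u < n ] card (λ w → C u ∧ T u w)
      ≡⟨ sum-cong-≗ degree-at-terminal ⟩
    degreeSumOn T C
      ∎
    where
    open ≤-Reasoning
    at-most-one-path : ∀ u w → ∑[ i < x ] 𝟙 (terminalDart (P i) u w) ≤ 𝟙 (C u ∧ T u w)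
    at-most-one-path u w with C u ∧ T u w
    ... | false = ≤-reflexive (sum-zero {x} (λ _ → refl))
    ... | true  = card≤1 (λ i → edgeIn u w (P i)) (disjoint u w)
    degree-at-terminal : ∀ u → card (λ w → C u ∧ T u w) ≡ (if C u then deg T u else 0)
    degree-at-terminal u with C u
    ... | true  = sym (deg≡card T u)
    ... | false = sum-zero {n} (λ _ → refl)

-- Counting terminals

touches : ∀ {n} → EdgeRel n → VSet n
touches {n} F u = any (F u) (allFin n)

-- This is setC G S F for T = forestT G S F.  Keeping T abstract lets a case split on S u leave
-- deg T u untouched.
terminals : ∀ {n} → EdgeRel n → EdgeRel n → VSet n → VSet n
terminals T F S u = (S u ∧ (3 ≤ᵇ deg T u)) ∨ touches F u

branching : ∀ {n} → EdgeRel n → EdgeRel n → VSet n → VSet n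
branching T F S u = S u ∧ (3 ≤ᵇ deg T u) ∧ not (touches F u)

slack-transfer : ∀ {a s b f} → a + 2 ≤ s → s + b ≤ a + f → b + 2 ≤ f
slack-transfer {a} {s} {b} {f} a+2≤s s+b≤a+f = +-cancelˡ-≤ s (b + 2) f (begin
  s + (b + 2)   ≡⟨ +-assoc s b 2 ⟨
  s + b + 2     ≤⟨ +-monoˡ-≤ 2 s+b≤a+f ⟩
  a + f + 2     ≡⟨ trans (+-assoc a f 2) (cong (a +_) (+-comm f 2)) ⟩
  a + (2 + f)   ≡⟨ +-assoc a 2 f ⟨
  a + 2 + f     ≤⟨ +-monoˡ-≤ f a+2≤s ⟩
  s + f         ∎)
  where open ≤-Reasoning

module _ {n} {T F : EdgeRel n} {S : VSet n} (forest : IsForestOn T S)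
         (F-sym : ∀ u w → F u w ≡ F w u) (F-irrefl : ∀ u → F u u ≡ false)
         (minDegree : ∀ u → S u ≡ true → 2 ≤ deg T u + deg F u) where

  open IsForestOn forest

  private
    B C L : VSet n
    B = branching T F S
    C = terminals T F S
    L = touches F

  deg-untouched : ∀ u → L u ≡ false → deg F u ≡ 0
  deg-untouched u = count-none (F u) (allFin n)

  deg-off-support : ∀ u → S u ≡ false → deg T u ≡ 0
  deg-off-support u Su≡false = trans (deg≡card T u) (sum-zero no-edge)
    where
    no-edge : ∀ w → 𝟙 (T u w) ≡ 0
    no-edge w with T u w in Tuw
    ... | false = refl
    ... | true  with () ← trans (sym (supported u w Tuw)) Su≡false

  pointwise-branching : ∀ u → 2 * 𝟙 (S u) + 𝟙 (B u) ≤ deg T u + deg F u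
  pointwise-branching u with S u in Su | 3 ≤ᵇ deg T u | ≤ᵇ-reflects-≤ 3 (deg T u) | L u
  ... | false | _     | _          | _     = z≤n
  ... | true  | true  | ofʸ 3≤degT | false = ≤-trans 3≤degT (m≤m+n _ _)
  ... | true  | true  | _          | true  = minDegree u Su
  ... | true  | false | _          | _     = minDegree u Su

  pointwise-terminalDegree : ∀ u → (if C u then deg T u else 0) + 2 * 𝟙 (S u)
                                   ≤ deg T u + 2 * 𝟙 (B u) + 2 * 𝟙 (L u)
  pointwise-terminalDegree u with S u in Su | 3 ≤ᵇ deg T u | L u in Lu
  ... | false | _     | false = z≤n
  ... | false | _     | true  = m≤m+n _ _
  ... | true  | true  | true  = ≤-reflexive (cong (_+ 2) (sym (+-identityʳ (deg T u))))
  ... | true  | false | true  = ≤-reflexive (cong (_+ 2) (sym (+-identityʳ (deg T u))))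
  ... | true  | true  | false = ≤-reflexive (sym (+-identityʳ _))
  ... | true  | false | false = ≤-trans (minDegree u Su)
    (≤-reflexive (trans (cong (deg T u +_) (deg-untouched u Lu)) (sym (+-identityʳ (deg T u + 0)))))

  pointwise-terminal : ∀ u → 𝟙 (C u) ≤ 𝟙 (B u) + 𝟙 (L u)
  pointwise-terminal u with S u | 3 ≤ᵇ deg T u | L u
  ... | true  | true  | false = ≤-refl
  ... | true  | true  | true  = ≤-refl
  ... | true  | false | true  = ≤-refl
  ... | false | _     | true  = ≤-refl
  ... | true  | false | false = z≤n
  ... | false | _     | false = z≤n

  branching+2≤degreeSum : ∀ v → S v ≡ true → card B + 2 ≤ ∑[ u < n ] deg F u
  branching+2≤degreeSum v Sv = slack-transfer (degreeSum+2≤2*card forest v Sv) (begin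
    2 * card S + card B                   ≡⟨ cong (_+ card B) (sum-2* (𝟙 ∘ S)) ⟨
    sum (λ u → 2 * 𝟙 (S u)) + card B      ≡⟨ ∑-distrib-+ (λ u → 2 * 𝟙 (S u)) (𝟙 ∘ B) ⟨
    sum (λ u → 2 * 𝟙 (S u) + 𝟙 (B u))    ≤⟨ sum-mono-≤ pointwise-branching ⟩
    sum (λ u → deg T u + deg F u)         ≡⟨ ∑-distrib-+ (deg T) (deg F) ⟩
    sum (deg T) + sum (deg F)             ∎)
    where open ≤-Reasoning

  degreeSumOn+2≤ : ∀ v → S v ≡ true → degreeSumOn T C + 2 ≤ 2 * card B + 2 * card L
  degreeSumOn+2≤ v Sv = slack-transfer (degreeSum+2≤2*card forest v Sv) (begin
    2 * card S + degreeSumOn T C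
      ≡⟨ trans (+-comm (2 * card S) (sum c)) (cong (sum c +_) (sym (sum-2* (𝟙 ∘ S)))) ⟩
    sum c + sum (λ u → 2 * 𝟙 (S u))
      ≡⟨ ∑-distrib-+ c (λ u → 2 * 𝟙 (S u)) ⟨
    sum (λ u → c u + 2 * 𝟙 (S u))
      ≤⟨ sum-mono-≤ pointwise-terminalDegree ⟩
    sum (λ u → deg T u + 2 * 𝟙 (B u) + 2 * 𝟙 (L u))
      ≡⟨ trans (∑-distrib-+ (λ u → deg T u + 2 * 𝟙 (B u)) (λ u → 2 * 𝟙 (L u)))
               (cong₂ _+_ (∑-distrib-+ (deg T) (λ u → 2 * 𝟙 (B u))) (sum-2* (𝟙 ∘ L))) ⟩
    sum (deg T) + sum (λ u → 2 * 𝟙 (B u)) + 2 * card L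
      ≡⟨ trans (cong (λ b → sum (deg T) + b + 2 * card L) (sum-2* (𝟙 ∘ B)))
               (+-assoc (sum (deg T)) _ _) ⟩
    sum (deg T) + (2 * card B + 2 * card L)
      ∎)
    where
    open ≤-Reasoning
    c : Fin n → ℕ
    c u = if C u then deg T u else 0

  card-touches≤degreeSum : card L ≤ ∑[ u < n ] deg F u
  card-touches≤degreeSum = sum-mono-≤ (λ u → 𝟙-any≤count (F u) (allFin n))

  card-branching≤degreeSum : card B ≤ ∑[ u < n ] deg F u
  card-branching≤degreeSum with Finₚ.any? (λ v → S v Bool.≟ true)
  ... | yes (v , Sv) = ≤-trans (m≤m+n (card B) 2) (branching+2≤degreeSum v Sv)
  ... | no  none     = ≤-trans (≤-reflexive (sum-zero not-branching)) z≤n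
    where
    not-branching : ∀ u → 𝟙 (B u) ≡ 0
    not-branching u with S u in Su
    ... | true  = contradiction (u , Su) none
    ... | false = refl

  private
    F-handshake : ∑[ u < n ] deg F u ≤ 2 * numEdges F
    F-handshake = degreeSum≤2*numEdges F F-sym F-irrefl

  card-terminals≤4*numEdges : card C ≤ 4 * numEdges F
  card-terminals≤4*numEdges = begin
    card C                           ≤⟨ sum-mono-≤ pointwise-terminal ⟩
    sum (λ u → 𝟙 (B u) + 𝟙 (L u))    ≡⟨ ∑-distrib-+ (𝟙 ∘ B) (𝟙 ∘ L) ⟩
    card B + card L                  ≤⟨ +-mono-≤ card-branching≤degreeSum card-touches≤degreeSum ⟩
    sum (deg F) + sum (deg F)        ≤⟨ +-mono-≤ F-handshake F-handshake ⟩
    2 * numEdges F + 2 * numEdges F  ≡⟨ *-distribʳ-+ (numEdges F) 2 2 ⟨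
    4 * numEdges F                   ∎
    where open ≤-Reasoning

  pathCount-bound : ∀ x → 2 * x ≤ degreeSumOn T C → x ≡ 0 ⊎ x + 3 ≤ 4 * numEdges F
  pathCount-bound x 2x≤ with Finₚ.any? (λ v → S v Bool.≟ true)
  ... | yes (v , Sv) = inj₂ (*-cancelˡ-≤ 2 (begin
    2 * (x + 3)                           ≡⟨ *-distribˡ-+ 2 x 3 ⟩
    2 * x + 6                             ≤⟨ +-monoˡ-≤ 6 2x≤ ⟩
    degreeSumOn T C + 6                   ≡⟨ +-assoc (degreeSumOn T C) 2 4 ⟨
    degreeSumOn T C + 2 + 4               ≤⟨ +-monoˡ-≤ 4 (degreeSumOn+2≤ v Sv) ⟩
    2 * card B + 2 * card L + 4           ≡⟨ regroup (card B) (card L) ⟩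
    2 * (card B + 2) + 2 * card L         ≤⟨ +-mono-≤ (*-monoʳ-≤ 2 (branching+2≤degreeSum v Sv))
                                                      (*-monoʳ-≤ 2 card-touches≤degreeSum) ⟩
    2 * sum (deg F) + 2 * sum (deg F)     ≤⟨ +-mono-≤ (*-monoʳ-≤ 2 F-handshake)
                                                      (*-monoʳ-≤ 2 F-handshake) ⟩
    2 * (2 * k) + 2 * (2 * k)             ≡⟨ regroup′ k ⟩
    2 * (4 * k)                           ∎))
    where
    open ≤-Reasoning
    k : ℕ
    k = numEdges F
    regroup : ∀ b l → 2 * b + 2 * l + 4 ≡ 2 * (b + 2) + 2 * l
    regroup = solve-∀
    regroup′ : ∀ k → 2 * (2 * k) + 2 * (2 * k) ≡ 2 * (4 * k)
    regroup′ = solve-∀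
  ... | no  none = inj₁ (*-cancelˡ-≡ x 0 2 (n≤0⇒n≡0 (≤-trans 2x≤ (≤-reflexive (sum-zero no-degree)))))
    where
    no-degree : ∀ u → (if C u then deg T u else 0) ≡ 0
    no-degree u with C u
    ... | false = refl
    ... | true  with S u in Su
    ...   | true  = contradiction (u , Su) none
    ...   | false = deg-off-support u Su

-- Growth below the threshold

card-memB≤length : ∀ {n} (p : List (Fin n)) → card (λ w → memB w p) ≤ length p
card-memB≤length {n} []      = ≤-reflexive (sum-zero {n} (λ _ → refl))
card-memB≤length     (y ∷ p) = begin
  card (λ w → eqB w y ∨ memB w p)
    ≤⟨ card-∨ (λ w → eqB w y) (λ w → memB w p) ⟩
  card (λ w → eqB w y) + card (λ w → memB w p)
    ≤⟨ +-mono-≤ (≤-reflexive (sum-select (λ _ → 1) y)) (card-memB≤length p) ⟩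
  1 + length p
    ∎
  where open ≤-Reasoning

module _ {n x} (F : EdgeRel n) (P : Fin x → List (Fin n)) where

  lengthsBelow : ℕ → ℕ
  lengthsBelow i = ∑[ l < x ] (if toℕ l <ᵇ i then length (P l) else 0)

  lengthsBelow-0 : lengthsBelow 0 ≡ 0
  lengthsBelow-0 = sum-zero {x} (λ _ → refl)

  lengthsBelow-suc : ∀ l → lengthsBelow (suc (toℕ l)) ≤ lengthsBelow (toℕ l) + length (P l)
  lengthsBelow-suc l = begin
    lengthsBelow (suc (toℕ l))
      ≤⟨ sum-mono-≤ split ⟩
    ∑[ l′ < x ] ((if toℕ l′ <ᵇ toℕ l then length (P l′) else 0)
                 + (if eqB l′ l then length (P l′) else 0))
      ≡⟨ ∑-distrib-+ (λ l′ → if toℕ l′ <ᵇ toℕ l then length (P l′) else 0) _ ⟩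
    lengthsBelow (toℕ l) + ∑[ l′ < x ] (if eqB l′ l then length (P l′) else 0)
      ≡⟨ cong (lengthsBelow (toℕ l) +_) (sum-select (length ∘ P) l) ⟩
    lengthsBelow (toℕ l) + length (P l)
      ∎
    where
    open ≤-Reasoning
    split : ∀ l′ → (if toℕ l′ <ᵇ suc (toℕ l) then length (P l′) else 0)
                 ≤ (if toℕ l′ <ᵇ toℕ l then length (P l′) else 0)
                   + (if eqB l′ l then length (P l′) else 0)
    split l′ with toℕ l′ <ᵇ suc (toℕ l) | <ᵇ-reflects-< (toℕ l′) (suc (toℕ l))
                | toℕ l′ <ᵇ toℕ l       | <ᵇ-reflects-< (toℕ l′) (toℕ l)
    ... | false | _        | _     | _        = z≤n
    ... | true  | _        | true  | _        = m≤m+n _ _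
    ... | true  | ofʸ l′≤l | false | ofⁿ l′≮l
      rewrite Finₚ.toℕ-injective (≤-antisym (s≤s⁻¹ l′≤l) (≮⇒≥ l′≮l)) | eqB-refl l = ≤-refl

  numEdges-edgesGi : ∀ i → numEdges (edgesGi F P i) ≤ numEdges F + lengthsBelow i
  numEdges-edgesGi i = begin
    numEdges (edgesGi F P i)
      ≤⟨ numEdges-∨ F (λ u w → any (λ l → φ l u w) (allFin x)) ⟩
    numEdges F + numEdges (λ u w → any (λ l → φ l u w) (allFin x))
      ≤⟨ +-monoʳ-≤ (numEdges F) (numEdges-any φ (allFin x)) ⟩
    numEdges F + ℕ-List.sum (map (numEdges ∘ φ) (allFin x))
      ≡⟨ cong (numEdges F +_) (listSum-allFin (numEdges ∘ φ)) ⟩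
    numEdges F + ∑[ l < x ] numEdges (φ l)
      ≤⟨ +-monoʳ-≤ (numEdges F) (sum-mono-≤ path-edges) ⟩
    numEdges F + lengthsBelow i
      ∎
    where
    open ≤-Reasoning
    φ : Fin x → EdgeRel n
    φ l u w = (toℕ l <ᵇ i) ∧ edgeIn u w (P l)
    path-edges : ∀ l → numEdges (φ l) ≤ (if toℕ l <ᵇ i then length (P l) else 0)
    path-edges l with toℕ l <ᵇ i
    ... | true  = ≤-trans (numEdges-edgeIn (P l)) (m∸n≤m (length (P l)) 1)
    ... | false = ≤-reflexive (numEdges-empty {n})

  card-vertsGi : ∀ (C : VSet n) i → card (vertsGi C P i) ≤ card C + lengthsBelow i
  card-vertsGi C i = begin
    card (vertsGi C P i)
      ≤⟨ sum-mono-≤ (λ w → ≤-trans (𝟙-∨ (C w) _)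
                                   (+-monoʳ-≤ (𝟙 (C w)) (𝟙-any≤count (λ l → ψ l w) (allFin x)))) ⟩
    ∑[ w < n ] (𝟙 (C w) + count (λ l → ψ l w) (allFin x))
      ≡⟨ trans (∑-distrib-+ (𝟙 ∘ C) _)
               (cong (card C +_) (sum-cong-≗ (λ w → count-allFin (λ l → ψ l w)))) ⟩
    card C + ∑[ w < n ] ∑[ l < x ] 𝟙 (ψ l w)
      ≡⟨ cong (card C +_) (∑-comm (λ w l → 𝟙 (ψ l w))) ⟩
    card C + ∑[ l < x ] card (ψ l)
      ≤⟨ +-monoʳ-≤ (card C) (sum-mono-≤ path-vertices) ⟩
    card C + lengthsBelow i
      ∎
    where
    open ≤-Reasoning
    ψ : Fin x → VSet n
    ψ l w = (toℕ l <ᵇ i) ∧ memB w (P l)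
    path-vertices : ∀ l → card (ψ l) ≤ (if toℕ l <ᵇ i then length (P l) else 0)
    path-vertices l with toℕ l <ᵇ i
    ... | true  = card-memB≤length (P l)
    ... | false = ≤-reflexive (sum-zero {n} (λ _ → refl))

  module _ (j : ℕ) (j≤x : j ≤ x)
           (short : ∀ (l : Fin x) → toℕ l < j →
                    pathLen (P l) ≤ 2 * (numEdges (edgesGi F P (toℕ l)) + x)) where

    lengthsBelow-growth : ∀ i → i ≤ j →
                          lengthsBelow i + (numEdges F + x + 1) ≤ 3 ^ i * (numEdges F + x + 1)
    lengthsBelow-growth zero _ =
      ≤-reflexive (trans (cong (_+ (numEdges F + x + 1)) lengthsBelow-0) (sym (+-identityʳ _)))
    lengthsBelow-growth (suc i) 1+i≤j = begin
      lengthsBelow (suc i) + c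
        ≤⟨ +-monoˡ-≤ c add-path ⟩
      lengthsBelow i + length (P l) + c
        ≤⟨ +-monoˡ-≤ c (+-monoʳ-≤ (lengthsBelow i) path-length) ⟩
      lengthsBelow i + (1 + 2 * (k + lengthsBelow i + x)) + c
        <⟨ ≤-reflexive (tripling (lengthsBelow i) k x) ⟩
      3 * (lengthsBelow i + c)
        ≤⟨ *-monoʳ-≤ 3 (lengthsBelow-growth i (<⇒≤ 1+i≤j)) ⟩
      3 * (3 ^ i * c)
        ≡⟨ *-assoc 3 (3 ^ i) c ⟨
      3 ^ suc i * c
        ∎
      where
      open ≤-Reasoning
      k c : ℕ
      k = numEdges F
      c = k + x + 1
      i<x : i < x
      i<x = ≤-trans 1+i≤j j≤x
      l : Fin x
      l = fromℕ< i<x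
      l≡i : toℕ l ≡ i
      l≡i = Finₚ.toℕ-fromℕ< i<x
      add-path : lengthsBelow (suc i) ≤ lengthsBelow i + length (P l)
      add-path =
        subst (λ m → lengthsBelow (suc m) ≤ lengthsBelow m + length (P l)) l≡i (lengthsBelow-suc l)
      edges-before : numEdges (edgesGi F P (toℕ l)) ≤ k + lengthsBelow i
      edges-before =
        subst (λ m → numEdges (edgesGi F P m) ≤ k + lengthsBelow i) (sym l≡i) (numEdges-edgesGi i)
      path-length : length (P l) ≤ 1 + 2 * (k + lengthsBelow i + x)
      path-length = ≤-trans (m≤n+m∸n (length (P l)) 1)
        (+-monoʳ-≤ 1 (≤-trans (short l (subst (_< j) (sym l≡i) 1+i≤j))
                              (*-monoʳ-≤ 2 (+-monoˡ-≤ x edges-before))))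
      tripling : ∀ U k x → suc (U + (1 + 2 * (k + U + x)) + (k + x + 1)) ≡ 3 * (U + (k + x + 1))
      tripling = solve-∀

    lengthsBelow≤ : x ≡ 0 ⊎ x + 3 ≤ 4 * numEdges F → lengthsBelow j ≤ 5 * numEdges F * 81 ^ numEdges F
    lengthsBelow≤ (inj₁ refl) with refl ← n≤0⇒n≡0 j≤x = ≤-trans (≤-reflexive lengthsBelow-0) z≤n
    lengthsBelow≤ (inj₂ x+3≤4k) = begin
      lengthsBelow j              ≤⟨ m≤m+n (lengthsBelow j) c ⟩
      lengthsBelow j + c          ≤⟨ lengthsBelow-growth j ≤-refl ⟩
      3 ^ j * c                   ≤⟨ *-mono-≤ 3^j≤81^k c≤5k ⟩
      81 ^ k * (5 * k)            ≡⟨ *-comm (81 ^ k) (5 * k) ⟩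
      5 * k * 81 ^ k              ∎
      where
      open ≤-Reasoning
      k c : ℕ
      k = numEdges F
      c = k + x + 1
      3^j≤81^k : 3 ^ j ≤ 81 ^ k
      3^j≤81^k = ≤-trans (^-monoʳ-≤ 3 (≤-trans j≤x (≤-trans (m≤m+n x 3) x+3≤4k)))
                         (≤-reflexive (sym (^-*-assoc 3 4 k)))
      c≤5k : c ≤ 5 * k
      c≤5k = ≤-trans (≤-reflexive (+-assoc k x 1)) (+-monoʳ-≤ k (≤-trans (+-monoʳ-≤ x (s≤s z≤n)) x+3≤4k))

deg≤deg─+deg : ∀ {n} (R F : EdgeRel n) u → deg R u ≤ deg (R ─ F) u + deg F u
deg≤deg─+deg R F u = begin
  deg R u                                   ≡⟨ deg≡card R u ⟩
  card (R u)                                ≤⟨ sum-mono-≤ (λ w → split (R u w) (F u w)) ⟩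
  sum (λ w → 𝟙 ((R ─ F) u w) + 𝟙 (F u w))   ≡⟨ ∑-distrib-+ (𝟙 ∘ (R ─ F) u) (𝟙 ∘ F u) ⟩
  card ((R ─ F) u) + card (F u)             ≡⟨ cong₂ _+_ (deg≡card (R ─ F) u) (deg≡card F u) ⟨
  deg (R ─ F) u + deg F u                   ∎
  where
  open ≤-Reasoning
  split : ∀ r f → 𝟙 r ≤ 𝟙 (r ∧ not f) + 𝟙 f
  split false _     = z≤n
  split true  false = ≤-refl
  split true  true  = ≤-refl

module _ {n} (G : Graph n) {F : EdgeRel n} (feedback : IsFeedbackEdgeSet G F) where

  private
    F⊆G : ∀ u w → F u w ≡ true → adj G u w ≡ true
    F⊆G = proj₁ feedback

  F-irreflexive : ∀ u → F u u ≡ false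
  F-irreflexive u with F u u in Fuu
  ... | false = refl
  ... | true  = trans (sym (F⊆G u u Fuu)) (irrefl G u)

  forestT-isForest : ∀ S → IsForestOn (forestT G S F) S
  forestT-isForest S = record
    { symmetric   = λ u w → cong₂ _∧_ (cong₂ _∧_ (Graph.sym G u w) (Bool.∧-comm (S u) (S w)))
                                      (cong not (proj₁ (proj₂ feedback) u w))
    ; irreflexive = λ u → cong (λ b → (b ∧ (S u ∧ S u)) ∧ not (F u u)) (irrefl G u)
    ; acyclic     = Acyclic-mono in-G─F (proj₂ (proj₂ feedback))
    ; supported   = λ u w Tuw → proj₁ (∧-true (proj₂ (in-G[S] u w Tuw)))
    }
    where
    in-G[S] : ∀ u w → forestT G S F u w ≡ true → adj G u w ≡ true × (S u ∧ S w) ≡ true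
    in-G[S] u w Tuw = ∧-true {adj G u w} (proj₁ (∧-true {induced (adj G) S u w} Tuw))
    in-G─F : ∀ u w → forestT G S F u w ≡ true → (adj G ─ F) u w ≡ true
    in-G─F u w Tuw =
      cong₂ _∧_ (proj₁ (in-G[S] u w Tuw)) (proj₂ (∧-true {induced (adj G) S u w} Tuw))

-- Not used: the minimality of F, the peeling sequence, that the paths cover T and are sorted,
-- and the minimality of j.
mainTheorem10 : ∀ (n : ℕ) (G : Graph n) (F : EdgeRel n) →
    IsMinFeedbackEdgeSet G F →
    ∀ (k : ℕ) → numEdges F ≡ k →
    ∀ (S : VSet n) → IsExhaustivePeel G S →
    ∀ (x : ℕ) (P : Fin x → List (Fin n)) →
    IsSortedDecomposition (forestT G S F) (setC G S F) x P →
    ∀ (j : ℕ) → IsThresholdIndex F x P j →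
    size (vertsGi (setC G S F) P j) ≤ 10 * k * 81 ^ k
mainTheorem10 n G F (feedback , _) k refl S (_ , minDegree) x P (paths , _ , disjoint , _)
              j (j≤x , short , _) = begin
  size (vertsGi (setC G S F) P j)         ≡⟨ size≡card (vertsGi (setC G S F) P j) ⟩
  card (vertsGi (setC G S F) P j)         ≤⟨ card-vertsGi F P (setC G S F) j ⟩
  card (setC G S F) + lengthsBelow F P j  ≤⟨ +-mono-≤ (card-terminals≤4*numEdges forest F-sym F-irrefl T∪F-minDegree)
                                                     (lengthsBelow≤ F P j j≤x short pathCount) ⟩
  4 * k + 5 * k * 81 ^ k                  ≤⟨ +-monoˡ-≤ (5 * k * 81 ^ k) 4k≤5k*81^k ⟩
  5 * k * 81 ^ k + 5 * k * 81 ^ k         ≡⟨ doubling k (81 ^ k) ⟩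
  10 * k * 81 ^ k                         ∎
  where
  open ≤-Reasoning
  forest : IsForestOn (forestT G S F) S
  forest = forestT-isForest G feedback S
  F-sym : ∀ u w → F u w ≡ F w u
  F-sym = proj₁ (proj₂ feedback)
  F-irrefl : ∀ u → F u u ≡ false
  F-irrefl = F-irreflexive G feedback
  T∪F-minDegree : ∀ u → S u ≡ true → 2 ≤ deg (forestT G S F) u + deg F u
  T∪F-minDegree u Su = ≤-trans (minDegree u Su) (deg≤deg─+deg (induced (adj G) S) F u)
  pathCount : x ≡ 0 ⊎ x + 3 ≤ 4 * k
  pathCount = pathCount-bound forest F-sym F-irrefl T∪F-minDegree x
                (2*pathCount≤degreeSumOn (IsForestOn.symmetric forest) x P paths disjoint)
  4k≤5k*81^k : 4 * k ≤ 5 * k * 81 ^ k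
  4k≤5k*81^k = ≤-trans (m≤n+m (4 * k) k) (m≤m*n (5 * k) (81 ^ k) {{m^n≢0 81 k}})
  doubling : ∀ k m → 5 * k * m + 5 * k * m ≡ 10 * k * m
  doubling = solve-∀
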